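{- If a finite simple graph $G$ has diameter $d$, then $P(G)\ge d$.
   Context: A distribution of pegs on $G$ is a subset $D \subseteq V(G)$. If $u,v \in D$ are distinct adjacent vertices and $w \notin D$ is a vertex adjacent to $v$, the pegging move (jumping $u$ over $v$ into $w$) replaces $D$ by $(D\setminus\{u,v\})\cup\{w\}$. A vertex $t$ is reachable from $D$ if some finite (possibly empty) sequence of pegging moves starting from $D$ ends in a distribution containing $t$. The pegging number $P(G)$ is the smallest positive integer $d$ such that every distribution of size $d$ on $G$ has every vertex reachable. -}

module Defs where

open import Data.Nat using (ℕ; zero; suc; _≤_; _<_)
open import Data.Fin using (Fin)
open import Data.Fin.Subset using (Subset; _∈_; _∉_; _∪_; _-_; ⁅_⁆; ∣_∣)
open import Data.Product using (Σ; ∃; ∃-syntax; _×_; _,_)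
open import Relation.Binary.PropositionalEquality using (_≡_; _≢_)
open import Relation.Binary.Construct.Closure.ReflexiveTransitive using (Star)
open import Relation.Nullary using (¬_)
open import Level using (0ℓ)

record SimpleGraph (n : ℕ) : Set₁ where
  field
    Adj    : Fin n → Fin n → Set
    sym    : ∀ {u v} → Adj u v → Adj v u
    irrefl : ∀ {u} → ¬ Adj u u
open SimpleGraph public

module _ {n : ℕ} (G : SimpleGraph n) where

  data Walk : Fin n → Fin n → ℕ → Set where
    here : ∀ {u} → Walk u u zero
    step : ∀ {u v w k} → Adj G u v → Walk v w k → Walk u w (suc k)

  Dist : Fin n → Fin n → ℕ → Set
  Dist u v k = Walk u v k × (∀ j → j < k → ¬ Walk u v j)

  Connected : Set
  Connected = ∀ u v → ∃[ k ] Walk u v k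

  HasDiameter : ℕ → Set
  HasDiameter d =
    Connected
    × (∀ u v k → Dist u v k → k ≤ d)
    × (∃[ u ] ∃[ v ] Dist u v d)

  data Move : Subset n → Subset n → Set where
    jump : ∀ {D} u v w →
           u ∈ D → v ∈ D → u ≢ v → Adj G u v →
           w ∉ D → Adj G v w →
           Move D (((D - u) - v) ∪ ⁅ w ⁆)

  Reachable : Subset n → Fin n → Set
  Reachable D t = ∃[ D' ] (Star Move D D' × t ∈ D')

  AllReachableAt : ℕ → Set
  AllReachableAt p = ∀ (D : Subset n) → ∣ D ∣ ≡ p → ∀ t → Reachable D t

  IsPeggingNumber : ℕ → Set
  IsPeggingNumber p =
    1 ≤ p × AllReachableAt p × (∀ q → 1 ≤ q → AllReachableAt q → p ≤ q)

-- Let u, v be at distance d and ℓ(x) = d − dist(u, x). The weight fib ∘ ℓ is a pagoda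
-- function: since ℓ changes by at most 1 along an edge, the landing vertex of a jump weighs at
-- most as much as the two pegs it removes, so the total weight never increases. Placing
-- p < d pegs on the p vertices of a u–v geodesic farthest from u gives total weight at most
-- fib 0 + ⋯ + fib (p − 1) < fib (p + 1) ≤ fib d, the weight of u, so u is unreachable.

module Submission where

open import Defs
open import Data.Nat using (ℕ; zero; suc; pred; _+_; _∸_; _≤_; _<_; z≤n; s≤s; _≤?_)
open import Data.Nat.Properties hiding (_≟_)
open import Data.Fin using (Fin; zero; suc; _≟_)
open import Data.Fin.Properties using (∀-cons; any?)
open import Data.Fin.Subset using (Subset; _∈_; _∉_; _∪_; _-_; ⁅_⁆; ∣_∣; ⊥; inside; outside)
open import Data.Fin.Subset.Properties using (x∈p∪q⁻; x∈⁅y⁆⇒x≡y; ∉⊥; x∈p∧x≢y⇒x∈p-y; p─q⊆p; p─⊥≡p; ∪-identityʳ)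
open import Data.Vec using (_∷_; []; here; there)
open import Data.Product using (∃-syntax; _×_; _,_)
open import Data.Sum using (_⊎_; inj₁; inj₂; map₂)
open import Data.Empty using (⊥-elim)
open import Function using (_∘_)
open import Relation.Nullary using (¬_; Dec; yes; no; _×-dec_; map′)
open import Relation.Nullary.Decidable using (¬¬-excluded-middle)
open import Relation.Binary.Definitions using (Decidable)
open import Relation.Binary.PropositionalEquality using (_≡_; _≢_; refl; cong; subst; trans; module ≡-Reasoning)
  renaming (sym to ≡-sym)
open import Relation.Binary.Construct.Closure.ReflexiveTransitive using (Star; ε; _◅_)

¬¬-∀-Fin : ∀ {m} {P : Fin m → Set} → (∀ i → ¬ ¬ P i) → ¬ ¬ (∀ i → P i)
¬¬-∀-Fin {zero}  _   k = k (λ ())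
¬¬-∀-Fin {suc m} ¬¬P k = ¬¬P zero λ p₀ → ¬¬-∀-Fin (¬¬P ∘ suc) λ ps → k (∀-cons p₀ ps)

¬¬-decidable : ∀ {m} (R : Fin m → Fin m → Set) → ¬ ¬ Decidable R
¬¬-decidable R = ¬¬-∀-Fin λ a → ¬¬-∀-Fin λ b → ¬¬-excluded-middle

m≤1+n⇒o∸n≤1+o∸m : ∀ {m n} o → m ≤ suc n → o ∸ n ≤ suc (o ∸ m)
m≤1+n⇒o∸n≤1+o∸m {zero}        {n}     o       _         = ≤-trans (m∸n≤m o n) (n≤1+n o)
m≤1+n⇒o∸n≤1+o∸m {suc m}       {n}     zero    _         = ≤-trans (≤-reflexive (0∸n≡0 n)) z≤n
m≤1+n⇒o∸n≤1+o∸m {suc zero}    {zero}  (suc o) _         = ≤-refl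
m≤1+n⇒o∸n≤1+o∸m {suc (suc m)} {zero}  (suc o) (s≤s ())
m≤1+n⇒o∸n≤1+o∸m {suc m}       {suc n} (suc o) (s≤s m≤n) = m≤1+n⇒o∸n≤1+o∸m o m≤n

fib : ℕ → ℕ
fib zero          = 1
fib (suc zero)    = 1
fib (suc (suc k)) = fib (suc k) + fib k

fib-≤-suc : ∀ k → fib k ≤ fib (suc k)
fib-≤-suc zero    = ≤-refl
fib-≤-suc (suc k) = m≤m+n (fib (suc k)) (fib k)

fib-mono-≤ : ∀ {m n} → m ≤ n → fib m ≤ fib n
fib-mono-≤ m≤n with m≤n⇒m<n∨m≡n m≤n
... | inj₂ refl               = ≤-refl
... | inj₁ (s≤s {n = k} m≤k) = ≤-trans (fib-mono-≤ m≤k) (fib-≤-suc k)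

fib-suc-≤ : ∀ k → fib (suc k) ≤ fib k + fib (pred k)
fib-suc-≤ zero    = s≤s z≤n
fib-suc-≤ (suc k) = ≤-refl

sumBelow : ℕ → (ℕ → ℕ) → ℕ
sumBelow zero    f = 0
sumBelow (suc k) f = sumBelow k f + f k

sumBelow-mono-≤ : ∀ k {f g} → (∀ j → j < k → f j ≤ g j) → sumBelow k f ≤ sumBelow k g
sumBelow-mono-≤ zero    f≤g = z≤n
sumBelow-mono-≤ (suc k) f≤g =
  +-mono-≤ (sumBelow-mono-≤ k λ j j<k → f≤g j (m<n⇒m<1+n j<k)) (f≤g k ≤-refl)

sumBelow-const-1 : ∀ k → sumBelow k (λ _ → 1) ≡ k
sumBelow-const-1 zero    = refl
sumBelow-const-1 (suc k) = trans (cong (_+ 1) (sumBelow-const-1 k)) (+-comm k 1)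

sumBelow-fib : ∀ k → sumBelow k fib < fib (suc k)
sumBelow-fib zero    = s≤s z≤n
sumBelow-fib (suc k) = +-monoˡ-< (fib k) (sumBelow-fib k)

module _ {P : ℕ → Set} (P? : ∀ k → Dec (P k)) where

  -- The least j ∈ [k, k + r) with P j, or k + r if there is none.
  searchFrom : ℕ → ℕ → ℕ
  searchFrom k zero    = k
  searchFrom k (suc r) with P? k
  ... | yes _ = k
  ... | no  _ = searchFrom (suc k) r

  searchFrom-sound : ∀ k r → P (searchFrom k r) ⊎ searchFrom k r ≡ k + r
  searchFrom-sound k zero    = inj₂ (≡-sym (+-identityʳ k))
  searchFrom-sound k (suc r) with P? k
  ... | yes p = inj₁ p
  ... | no  _ = map₂ (λ eq → trans eq (≡-sym (+-suc k r))) (searchFrom-sound (suc k) r)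

  searchFrom-least : ∀ k r {j} → k ≤ j → P j → searchFrom k r ≤ j
  searchFrom-least k zero    k≤j _ = k≤j
  searchFrom-least k (suc r) k≤j p with P? k
  ... | yes _ = k≤j
  ... | no ¬p with m≤n⇒m<n∨m≡n k≤j
  ...   | inj₁ k<j  = searchFrom-least (suc k) r k<j p
  ...   | inj₂ refl = ⊥-elim (¬p p)

  searchFrom-≤ : ∀ k r → searchFrom k r ≤ k + r
  searchFrom-≤ k zero    = ≤-reflexive (≡-sym (+-identityʳ k))
  searchFrom-≤ k (suc r) with P? k
  ... | yes _ = m≤m+n k (suc r)
  ... | no  _ = ≤-trans (searchFrom-≤ (suc k) r) (≤-reflexive (≡-sym (+-suc k r)))

  leastBelow : ℕ → ℕ
  leastBelow = searchFrom 0

  leastBelow-sound : ∀ m → P (leastBelow m) ⊎ leastBelow m ≡ m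
  leastBelow-sound = searchFrom-sound 0

  leastBelow-least : ∀ m {j} → P j → leastBelow m ≤ j
  leastBelow-least m = searchFrom-least 0 m z≤n

  leastBelow-≤ : ∀ m → leastBelow m ≤ m
  leastBelow-≤ = searchFrom-≤ 0

weight : ∀ {n} → Subset n → (Fin n → ℕ) → ℕ
weight []            W = 0
weight (inside ∷ D)  W = W zero + weight D (W ∘ suc)
weight (outside ∷ D) W = weight D (W ∘ suc)

weight-const-1 : ∀ {n} (D : Subset n) → weight D (λ _ → 1) ≡ ∣ D ∣
weight-const-1 []            = refl
weight-const-1 (inside ∷ D)  = cong suc (weight-const-1 D)
weight-const-1 (outside ∷ D) = weight-const-1 D

weight-⊥ : ∀ {n} (W : Fin n → ℕ) → weight ⊥ W ≡ 0
weight-⊥ {zero}  W = refl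
weight-⊥ {suc n} W = weight-⊥ (W ∘ suc)

weight-p∪⁅x⁆ : ∀ {n} {D : Subset n} {x} (W : Fin n → ℕ) → x ∉ D → weight (D ∪ ⁅ x ⁆) W ≡ weight D W + W x
weight-p∪⁅x⁆ {D = inside ∷ D}  {zero}  W x∉D = ⊥-elim (x∉D here)
weight-p∪⁅x⁆ {D = outside ∷ D} {zero}  W x∉D =
  trans (cong (λ E → W zero + weight E (W ∘ suc)) (∪-identityʳ D)) (+-comm (W zero) _)
weight-p∪⁅x⁆ {D = inside ∷ D}  {suc x} W x∉D =
  trans (cong (W zero +_) (weight-p∪⁅x⁆ (W ∘ suc) (x∉D ∘ there))) (≡-sym (+-assoc (W zero) _ _))
weight-p∪⁅x⁆ {D = outside ∷ D} {suc x} W x∉D = weight-p∪⁅x⁆ (W ∘ suc) (x∉D ∘ there)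

weight-p-x : ∀ {n} {D : Subset n} {x} (W : Fin n → ℕ) → x ∈ D → weight (D - x) W + W x ≡ weight D W
weight-p-x {D = inside ∷ D}  {zero}  W here =
  trans (cong (λ E → weight E (W ∘ suc) + W zero) (p─⊥≡p D)) (+-comm _ (W zero))
weight-p-x {D = inside ∷ D}  {suc x} W (there x∈D) =
  trans (+-assoc (W zero) _ _) (cong (W zero +_) (weight-p-x (W ∘ suc) x∈D))
weight-p-x {D = outside ∷ D} {suc x} W (there x∈D) = weight-p-x (W ∘ suc) x∈D

weight-∈ : ∀ {n} {D : Subset n} {x} (W : Fin n → ℕ) → x ∈ D → W x ≤ weight D W
weight-∈ W x∈D = subst (W _ ≤_) (weight-p-x W x∈D) (m≤n+m _ _)

imageBelow : ∀ {n} → (ℕ → Fin n) → ℕ → Subset n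
imageBelow f zero    = ⊥
imageBelow f (suc k) = imageBelow f k ∪ ⁅ f k ⁆

∈-imageBelow⁻ : ∀ {n} {f : ℕ → Fin n} k {y} → y ∈ imageBelow f k → ∃[ j ] (j < k × y ≡ f j)
∈-imageBelow⁻ zero    y∈ = ⊥-elim (∉⊥ y∈)
∈-imageBelow⁻ {f = f} (suc k) y∈ with x∈p∪q⁻ (imageBelow f k) _ y∈
... | inj₂ y∈⁅fk⁆ = k , ≤-refl , x∈⁅y⁆⇒x≡y _ y∈⁅fk⁆
... | inj₁ y∈img with ∈-imageBelow⁻ k y∈img
...   | j , j<k , y≡fj = j , m<n⇒m<1+n j<k , y≡fj

InjectiveBelow : ∀ {n} → ℕ → (ℕ → Fin n) → Set
InjectiveBelow k f = ∀ {i j} → i < j → j < k → f i ≢ f j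

weight-imageBelow : ∀ {n} {f : ℕ → Fin n} k (W : Fin n → ℕ) →
                    InjectiveBelow k f → weight (imageBelow f k) W ≡ sumBelow k (W ∘ f)
weight-imageBelow         zero    W _   = weight-⊥ W
weight-imageBelow {f = f} (suc k) W inj = begin
  weight (imageBelow f k ∪ ⁅ f k ⁆) W  ≡⟨ weight-p∪⁅x⁆ W fk∉img ⟩
  weight (imageBelow f k) W + W (f k)  ≡⟨ cong (_+ W (f k)) (weight-imageBelow k W inj′) ⟩
  sumBelow k (W ∘ f) + W (f k)         ∎
  where
  open ≡-Reasoning
  inj′ : InjectiveBelow k f
  inj′ i<j j<k = inj i<j (m<n⇒m<1+n j<k)
  fk∉img : f k ∉ imageBelow f k
  fk∉img fk∈ with ∈-imageBelow⁻ k fk∈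
  ... | j , j<k , fk≡fj = inj j<k ≤-refl (≡-sym fk≡fj)

∣imageBelow∣ : ∀ {n} {f : ℕ → Fin n} k → InjectiveBelow k f → ∣ imageBelow f k ∣ ≡ k
∣imageBelow∣ {f = f} k inj = begin
  ∣ imageBelow f k ∣                  ≡⟨ ≡-sym (weight-const-1 (imageBelow f k)) ⟩
  weight (imageBelow f k) (λ _ → 1)  ≡⟨ weight-imageBelow k _ inj ⟩
  sumBelow k (λ _ → 1)               ≡⟨ sumBelow-const-1 k ⟩
  k                                  ∎
  where open ≡-Reasoning

module _ {n : ℕ} (G : SimpleGraph n) where

  Lipschitz : (Fin n → ℕ) → Set
  Lipschitz f = ∀ {a b} → Adj G a b → f b ≤ suc (f a)

  -- A pagoda function: no pegging move increases the total weight of a distribution.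
  Pagoda : (Fin n → ℕ) → Set
  Pagoda W = ∀ {a b c} → Adj G a b → Adj G b c → W c ≤ W a + W b

  ∸-lipschitz : ∀ m {f} → Lipschitz f → Lipschitz (λ x → m ∸ f x)
  ∸-lipschitz m lip ab = m≤1+n⇒o∸n≤1+o∸m m (lip (SimpleGraph.sym G ab))

  fib-pagoda : ∀ {ℓ} → Lipschitz ℓ → Pagoda (fib ∘ ℓ)
  fib-pagoda {ℓ} lip {a} {b} {c} ab bc = begin
    fib (ℓ c)                     ≤⟨ fib-mono-≤ (lip bc) ⟩
    fib (suc (ℓ b))               ≤⟨ fib-suc-≤ (ℓ b) ⟩
    fib (ℓ b) + fib (pred (ℓ b))  ≤⟨ +-monoʳ-≤ (fib (ℓ b)) (fib-mono-≤ (pred-mono-≤ (lip ab))) ⟩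
    fib (ℓ b) + fib (ℓ a)         ≡⟨ +-comm (fib (ℓ b)) (fib (ℓ a)) ⟩
    fib (ℓ a) + fib (ℓ b)         ∎
    where open ≤-Reasoning

  weight-move : ∀ {W D D′} → Pagoda W → Move G D D′ → weight D′ W ≤ weight D W
  weight-move {W} {D} pagoda (jump a b c a∈D b∈D a≢b ab c∉D bc) = begin
    weight ((D - a - b) ∪ ⁅ c ⁆) W      ≡⟨ weight-p∪⁅x⁆ W (c∉D ∘ p─q⊆p D _ ∘ p─q⊆p (D - a) _) ⟩
    weight (D - a - b) W + W c          ≤⟨ +-monoʳ-≤ _ (pagoda ab bc) ⟩
    weight (D - a - b) W + (W a + W b)  ≡⟨ cong (weight (D - a - b) W +_) (+-comm (W a) (W b)) ⟩
    weight (D - a - b) W + (W b + W a)  ≡⟨ ≡-sym (+-assoc _ (W b) (W a)) ⟩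
    weight (D - a - b) W + W b + W a    ≡⟨ cong (_+ W a) (weight-p-x W (x∈p∧x≢y⇒x∈p-y b∈D (a≢b ∘ ≡-sym))) ⟩
    weight (D - a) W + W a              ≡⟨ weight-p-x W a∈D ⟩
    weight D W                          ∎
    where open ≤-Reasoning

  weight-moves : ∀ {W D D′} → Pagoda W → Star (Move G) D D′ → weight D′ W ≤ weight D W
  weight-moves pagoda ε              = ≤-refl
  weight-moves pagoda (move ◅ moves) = ≤-trans (weight-moves pagoda moves) (weight-move pagoda move)

  reachable⇒≤weight : ∀ {W D t} → Pagoda W → Reachable G D t → W t ≤ weight D W
  reachable⇒≤weight {W} pagoda (D′ , moves , t∈D′) = ≤-trans (weight-∈ W t∈D′) (weight-moves pagoda moves)

  _++ᵂ_ : ∀ {a b c i j} → Walk G a b i → Walk G b c j → Walk G a c (i + j)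
  here      ++ᵂ w′ = w′
  step ab w ++ᵂ w′ = step ab (w ++ᵂ w′)

  _∷ʳᵂ_ : ∀ {a b c k} → Walk G a b k → Adj G b c → Walk G a c (suc k)
  here      ∷ʳᵂ bc = step bc here
  step ab w ∷ʳᵂ bc = step ab (w ∷ʳᵂ bc)

  -- Past the end of w, vertexAt w i is its endpoint.
  vertexAt : ∀ {a b k} → Walk G a b k → ℕ → Fin n
  vertexAt {a} w        zero    = a
  vertexAt {b = b} here (suc i) = b
  vertexAt (step _ w)   (suc i) = vertexAt w i

  takeᵂ : ∀ {a b k} (w : Walk G a b k) i → i ≤ k → Walk G a (vertexAt w i) i
  takeᵂ w           zero    _         = here
  takeᵂ (step ab w) (suc i) (s≤s i≤k) = step ab (takeᵂ w i i≤k)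

  dropᵂ : ∀ {a b k} (w : Walk G a b k) i → i ≤ k → Walk G (vertexAt w i) b (k ∸ i)
  dropᵂ w          zero    _         = w
  dropᵂ (step _ w) (suc i) (s≤s i≤k) = dropᵂ w i i≤k

  walk? : Decidable (Adj G) → ∀ a b k → Dec (Walk G a b k)
  walk? adj? a b zero with a ≟ b
  ... | yes refl = yes here
  ... | no  a≢b  = no λ { here → a≢b refl }
  walk? adj? a b (suc k) =
    map′ (λ (c , ac , cb) → step ac cb) uncons (any? λ c → adj? a c ×-dec walk? adj? c b k)
    where
    uncons : Walk G a b (suc k) → ∃[ c ] (Adj G a c × Walk G c b k)
    uncons (step ac cb) = _ , ac , cb

  module Geodesic {u v d} (w : Walk G u v d) (shortest : ∀ j → j < d → ¬ Walk G u v j) where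

    at : ℕ → Fin n
    at = vertexAt w

    walk-to-at-≥ : ∀ {i j} → i ≤ d → Walk G u (at i) j → i ≤ j
    walk-to-at-≥ {i} {j} i≤d w′ with i ≤? j
    ... | yes i≤j = i≤j
    ... | no  i≰j = ⊥-elim (shortest _ shorter (w′ ++ᵂ dropᵂ w i i≤d))
      where
      shorter : j + (d ∸ i) < d
      shorter = begin-strict
        j + (d ∸ i)  <⟨ +-monoˡ-< (d ∸ i) (≰⇒> i≰j) ⟩
        i + (d ∸ i)  ≡⟨ m+[n∸m]≡n i≤d ⟩
        d            ∎
        where open ≤-Reasoning

    at-injective : ∀ {i j} → i < j → j ≤ d → at i ≢ at j
    at-injective {i} {j} i<j j≤d ati≡atj =
      <⇒≱ i<j (walk-to-at-≥ j≤d (subst (λ x → Walk G u x i) ati≡atj (takeᵂ w i (≤-trans (<⇒≤ i<j) j≤d))))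

module FibonacciWeight {n} (G : SimpleGraph n) (adj? : Decidable (Adj G))
                       {u v d} (w : Walk G u v d) (shortest : ∀ j → j < d → ¬ Walk G u v j) where

  open Geodesic G w shortest

  -- The distance from u, truncated at d.
  dist : Fin n → ℕ
  dist x = leastBelow (walk? G adj? u x) d

  dist-u : dist u ≡ 0
  dist-u = n≤0⇒n≡0 (leastBelow-least _ d here)

  dist-lipschitz : Lipschitz G dist
  dist-lipschitz {a} {b} ab with leastBelow-sound (walk? G adj? u a) d
  ... | inj₁ ua     = leastBelow-least _ d (_∷ʳᵂ_ G ua ab)
  ... | inj₂ dist≡d = ≤-trans (leastBelow-≤ _ d) (≤-trans (≤-reflexive (≡-sym dist≡d)) (n≤1+n _))

  at-dist : ∀ {i} → i ≤ d → i ≤ dist (at i)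
  at-dist {i} i≤d with leastBelow-sound (walk? G adj? u (at i)) d
  ... | inj₁ walk   = walk-to-at-≥ i≤d walk
  ... | inj₂ dist≡d = subst (i ≤_) (≡-sym dist≡d) i≤d

  W : Fin n → ℕ
  W x = fib (d ∸ dist x)

  W-pagoda : Pagoda G W
  W-pagoda = fib-pagoda G (∸-lipschitz G d dist-lipschitz)

  far : ℕ → Fin n
  far k = at (d ∸ k)

  far-injective : ∀ {p} → p ≤ d → InjectiveBelow p far
  far-injective p≤d {i} {j} i<j j<p farᵢ≡farⱼ =
    at-injective (∸-monoʳ-< i<j j≤d) (m∸n≤m d i) (≡-sym farᵢ≡farⱼ)
    where
    j≤d : j ≤ d
    j≤d = ≤-trans (<⇒≤ j<p) p≤d

  W-far : ∀ {k} → k ≤ d → W (far k) ≤ fib k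
  W-far {k} k≤d = fib-mono-≤ (begin
    d ∸ dist (at (d ∸ k))  ≤⟨ ∸-monoʳ-≤ d (at-dist (m∸n≤m d k)) ⟩
    d ∸ (d ∸ k)            ≡⟨ m∸[m∸n]≡n k≤d ⟩
    k                      ∎)
    where open ≤-Reasoning

  ¬allReachable : ∀ {p} → p < d → ¬ AllReachableAt G p
  ¬allReachable {p} p<d allReachable = <⇒≱ initial<Wu Wu≤initial
    where
    p≤d : p ≤ d
    p≤d = <⇒≤ p<d
    initial : Subset n
    initial = imageBelow far p
    initial<Wu : weight initial W < W u
    initial<Wu = begin-strict
      weight initial W       ≡⟨ weight-imageBelow p W (far-injective p≤d) ⟩
      sumBelow p (W ∘ far)   ≤⟨ sumBelow-mono-≤ p (λ j j<p → W-far (≤-trans (<⇒≤ j<p) p≤d)) ⟩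
      sumBelow p fib         <⟨ sumBelow-fib p ⟩
      fib (suc p)            ≤⟨ fib-mono-≤ p<d ⟩
      fib d                  ≡⟨ cong (λ r → fib (d ∸ r)) (≡-sym dist-u) ⟩
      W u                    ∎
      where open ≤-Reasoning
    Wu≤initial : W u ≤ weight initial W
    Wu≤initial = reachable⇒≤weight G W-pagoda
                   (allReachable initial (∣imageBelow∣ p (far-injective p≤d)) u)

-- Decidability of adjacency is only available under double negation, which suffices since d ≤ p is decidable.
proposition2p3 : ∀ (n : ℕ) (G : SimpleGraph n) (d p : ℕ) →
    HasDiameter G d → IsPeggingNumber G p → d ≤ p
proposition2p3 n G d p (_ , _ , u , v , w , shortest) (_ , allReachable , _) with d ≤? p
... | yes d≤p = d≤p
... | no  d≰p = ⊥-elim (¬¬-decidable (Adj G) λ adj? →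
                  FibonacciWeight.¬allReachable G adj? w shortest (≰⇒> d≰p) allReachable)
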